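{- For any graph $G$ having at least one edge, $dem(G)<meg(G)$.
   Context: All graphs are finite and simple. A pair of vertices $u,v$ (or any vertex set containing them) monitors an edge $e$ if $e$ lies on every shortest $u$–$v$ path. A monitoring edge-geodetic set (MEG-set) of $G$ is a set $M\subseteq V(G)$ such that every edge of $G$ is monitored by some pair of vertices of $M$; $meg(G)$ is the minimum size of an MEG-set. A distance edge-monitoring set of $G$ is a set $S\subseteq V(G)$ such that for every edge $e$ there exist $x\in S$ and $y\in V(G)$ with $e$ lying on every shortest $x$–$y$ path; $dem(G)$ is the minimum size of such a set. -}

module Defs where

open import Level using (0ℓ)
open import Data.Nat using (ℕ; zero; suc; _≤_; _<_)
open import Data.Fin using (Fin)
open import Data.Fin.Subset using (Subset; _∈_; ∣_∣)
open import Data.Product using (Σ; ∃; ∃-syntax; _×_; _,_)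
open import Data.Sum using (_⊎_)
open import Relation.Binary.PropositionalEquality using (_≡_)
open import Relation.Nullary using (¬_)

record Graph (n : ℕ) : Set₁ where
  field
    Adj    : Fin n → Fin n → Set
    sym    : ∀ {u v} → Adj u v → Adj v u
    irrefl : ∀ {u} → ¬ Adj u u
open Graph public

module _ {n : ℕ} (G : Graph n) where

  data Walk : Fin n → Fin n → ℕ → Set where
    nil  : ∀ {u} → Walk u u zero
    cons : ∀ {u w v k} → Adj G u w → Walk w v k → Walk u v (suc k)

  IsShortest : ∀ {u v k} → Walk u v k → Set
  IsShortest {u} {v} {k} _ = ∀ {k′} → Walk u v k′ → k ≤ k′

  data OnWalk (a b : Fin n) : ∀ {u v k} → Walk u v k → Set where
    here  : ∀ {u w v k} (e : Adj G u w) (p : Walk w v k) →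
            (u ≡ a × w ≡ b) ⊎ (u ≡ b × w ≡ a) → OnWalk a b (cons e p)
    there : ∀ {u w v k} (e : Adj G u w) (p : Walk w v k) →
            OnWalk a b p → OnWalk a b (cons e p)

  Monitors : Fin n → Fin n → Fin n → Fin n → Set
  Monitors u v a b = ∀ {k} (p : Walk u v k) → IsShortest p → OnWalk a b p

  IsMEGSet : Subset n → Set
  IsMEGSet M = ∀ a b → Adj G a b →
    ∃[ u ] ∃[ v ] (u ∈ M × v ∈ M × Monitors u v a b)

  IsDEMSet : Subset n → Set
  IsDEMSet S = ∀ a b → Adj G a b →
    ∃[ x ] ∃[ y ] (x ∈ S × Monitors x y a b)

  IsMeg : ℕ → Set
  IsMeg k = (∃[ M ] (IsMEGSet M × ∣ M ∣ ≡ k)) × (∀ M → IsMEGSet M → k ≤ ∣ M ∣)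

  IsDem : ℕ → Set
  IsDem k = (∃[ S ] (IsDEMSet S × ∣ S ∣ ≡ k)) × (∀ S → IsDEMSet S → k ≤ ∣ S ∣)

  HasEdge : Set
  HasEdge = ∃[ a ] ∃[ b ] Adj G a b

-- A minimum MEG-set M contains a vertex x, since some pair in M monitors the given
-- edge. Removing x leaves a DEM-set: an edge monitored by u, v ∈ M has u ≠ v (the
-- trivial walk at u is a shortest u–u path and carries no edge), so one of u, v is not
-- x, and monitoring is symmetric because reversing a walk keeps its length and edges.
-- Hence dem(G) ≤ ∣M∣ - 1 < meg(G).
module Submission where

open import Defs
open import Data.Nat using (ℕ; suc; _<_; z≤n)
open import Data.Nat.Properties using (≤-<-trans)
open import Data.Fin using (Fin; _≟_)
open import Data.Fin.Subset using (Nonempty; _-_)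
open import Data.Fin.Subset.Properties using (x∈p∧x≢y⇒x∈p-y; x∈p⇒∣p-x∣<∣p∣)
open import Data.Product using (_×_; _,_)
import Data.Product as Prod
open import Data.Empty using (⊥-elim)
open import Data.Sum using (_⊎_; inj₁; inj₂)
import Data.Sum as Sum
open import Relation.Binary.PropositionalEquality using (_≡_; refl)
open import Relation.Nullary using (¬_; yes; no)
open import Function using (_∘′_)

module _ {n : ℕ} (G : Graph n) where

  EdgeIs : Fin n → Fin n → Fin n → Fin n → Set
  EdgeIs a b u w = (u ≡ a × w ≡ b) ⊎ (u ≡ b × w ≡ a)

  EdgeIs-sym : ∀ {a b u w} → EdgeIs a b u w → EdgeIs a b w u
  EdgeIs-sym = Sum.swap ∘′ Sum.map Prod.swap Prod.swap

  _∷ʳ_ : ∀ {u v w k} → Walk G u v k → Adj G v w → Walk G u w (suc k)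
  nil      ∷ʳ e = cons e nil
  cons f p ∷ʳ e = cons f (p ∷ʳ e)

  reverse : ∀ {u v k} → Walk G u v k → Walk G v u k
  reverse nil        = nil
  reverse (cons e p) = reverse p ∷ʳ Graph.sym G e

  OnWalk-∷ʳ⁻ : ∀ {a b u v w k} (p : Walk G u v k) (e : Adj G v w) →
               OnWalk G a b (p ∷ʳ e) → OnWalk G a b p ⊎ EdgeIs a b v w
  OnWalk-∷ʳ⁻ nil        e (here _ _ ab)  = inj₂ ab
  OnWalk-∷ʳ⁻ (cons f p) e (here _ _ ab)  = inj₁ (here f p ab)
  OnWalk-∷ʳ⁻ (cons f p) e (there _ _ on) = Sum.map₁ (there f p) (OnWalk-∷ʳ⁻ p e on)

  OnWalk-reverse⁻ : ∀ {a b u v k} (p : Walk G u v k) →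
                    OnWalk G a b (reverse p) → OnWalk G a b p
  OnWalk-reverse⁻ (cons e p) on with OnWalk-∷ʳ⁻ (reverse p) (Graph.sym G e) on
  ... | inj₁ on′ = there e p (OnWalk-reverse⁻ p on′)
  ... | inj₂ ab  = here e p (EdgeIs-sym ab)

  reverse-isShortest : ∀ {u v k} (p : Walk G u v k) →
                       IsShortest G p → IsShortest G (reverse p)
  reverse-isShortest p shortest q = shortest (reverse q)

  Monitors-sym : ∀ {u v a b} → Monitors G u v a b → Monitors G v u a b
  Monitors-sym mon p shortest =
    OnWalk-reverse⁻ p (mon (reverse p) (reverse-isShortest p shortest))

  ¬Monitors-refl : ∀ {u a b} → ¬ Monitors G u u a b
  ¬Monitors-refl mon with mon nil (λ _ → z≤n)
  ... | ()

  IsMEGSet⇒Nonempty : ∀ {M} → HasEdge G → IsMEGSet G M → Nonempty M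
  IsMEGSet⇒Nonempty (a , b , ab) isMEG =
    let u , _ , u∈M , _ = isMEG a b ab in u , u∈M

  IsMEGSet⇒IsDEMSet[-] : ∀ {M} x → IsMEGSet G M → IsDEMSet G (M - x)
  IsMEGSet⇒IsDEMSet[-] x isMEG a b ab with isMEG a b ab
  ... | u , v , u∈M , v∈M , mon with u ≟ x
  ...   | no u≢x = u , v , x∈p∧x≢y⇒x∈p-y u∈M u≢x , mon
  ...   | yes refl with v ≟ u
  ...     | yes refl = ⊥-elim (¬Monitors-refl mon)
  ...     | no v≢u   = v , u , x∈p∧x≢y⇒x∈p-y v∈M v≢u , Monitors-sym mon

mainTheorem18 : (n : ℕ) (G : Graph n) → HasEdge G →
    (d m : ℕ) → IsDem G d → IsMeg G m → d < m
mainTheorem18 n G hasEdge d m (_ , dem≤) ((M , isMEG , refl) , _) =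
  let x , x∈M = IsMEGSet⇒Nonempty G hasEdge isMEG
  in ≤-<-trans (dem≤ (M - x) (IsMEGSet⇒IsDEMSet[-] G x isMEG)) (x∈p⇒∣p-x∣<∣p∣ x∈M)
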